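{- Let $D=\{2^i\mid i\in\mathbb{Z}_{\ge0}\}$. Let $\mathbf{s}^{(1)}$ be the expansion of a binary string $\mathbf{s}$, and let $x_1<\dots<x_k$ be a $D$-diffsequence of positions in $\mathbf{s}^{(1)}$ that is monochromatic of color $c\in\{0,1\}$ (i.e. $s^{(1)}_{x_i}=c$ for all $i$). Suppose there exists $d\in\{0,1\}$ such that $s_{\mathrm{pos}(x_i)}=d$ for all $1\le i\le k$. Then the set $\{\mathrm{pos}(x_i)\}_{i=1}^k$ has at least $k-1$ distinct elements.
   Context: A $D$-diffsequence is a sequence of positive integers $a_1<\dots<a_k$ with $a_{i+1}-a_i\in D$ for all $i\in\{1,\dots,k-1\}$. The expansion of a binary string $\mathbf{s}$ of length $l$ is the binary string $\mathbf{s}^{(1)}$ of length $4l$ obtained by replacing each $0$ in $\mathbf{s}$ by $0011$ and each $1$ by $1100$; equivalently, for $i\in\{1,\dots,l\}$ and $j\in\{0,1,2,3\}$, $s^{(1)}_{4i-j}=s_i$ if $j\in\{2,3\}$ and $s^{(1)}_{4i-j}=1-s_i$ if $j\in\{0,1\}$. For a positive integer $i$, $\mathrm{pos}(i)=\lceil i/4\rceil$. -}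

module Defs where

open import Data.Nat using (ℕ; zero; suc; _+_; _*_; _∸_; _^_; _≤_; _<_)
open import Data.Nat.Properties using (_≟_)
open import Data.Bool using (Bool; not)
open import Data.Fin using (Fin; fromℕ<)
open import Data.Vec using (Vec; lookup)
open import Data.List using (List; []; _∷_; length; map; deduplicate)
open import Data.List.Relation.Unary.All using (All)
open import Data.Product using (∃; _×_; _,_)
open import Data.Sum using (_⊎_)
open import Relation.Binary.PropositionalEquality using (_≡_)

InD : ℕ → Set
InD n = ∃ λ i → n ≡ 2 ^ i

data DiffSeq : List ℕ → Set where
  nil  : DiffSeq []
  one  : ∀ {a} → 1 ≤ a → DiffSeq (a ∷ [])
  cons : ∀ {a b xs} → 1 ≤ a → a < b → InD (b ∸ a) → DiffSeq (b ∷ xs) → DiffSeq (a ∷ b ∷ xs)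

-- pos(i) = ⌈ i / 4 ⌉
pos : ℕ → ℕ
pos zero = zero
pos (suc n) = suc (n Data.Nat./ 4)

-- "p is a position of the expansion of a string of length l": 1 ≤ p ≤ 4l
ValidPos : ℕ → ℕ → Set
ValidPos l p = 1 ≤ p × p ≤ 4 * l

-- s_i for 1 ≤ i ≤ l (1-indexed)
at : ∀ {l} → Vec Bool l → (i : ℕ) → 1 ≤ i → i ≤ l → Bool
at s (suc i) _ i≤l = lookup s (fromℕ< i≤l)

-- expansion: s⁽¹⁾ of length 4l; for p = 4i - j (j ∈ {0,1,2,3}):
-- s⁽¹⁾_p = s_i if j ∈ {2,3}, and 1 - s_i if j ∈ {0,1}.
-- Given as a relation: Exp s p b means s⁽¹⁾_p = b.
Exp : ∀ {l} → Vec Bool l → ℕ → Bool → Set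
Exp {l} s p b = ∃ λ i → ∃ λ j → ∃ λ (h₁ : 1 ≤ i) → ∃ λ (h₂ : i ≤ l) →
  (j < 4) × (p + j ≡ 4 * i) ×
  (((j ≡ 2 ⊎ j ≡ 3) × b ≡ at s i h₁ h₂) ⊎ ((j ≡ 0 ⊎ j ≡ 1) × b ≡ not (at s i h₁ h₂)))

AtPos : ∀ {l} → Vec Bool l → ℕ → Bool → Set
AtPos {l} s p d = ∃ λ (h₁ : 1 ≤ pos p) → ∃ λ (h₂ : pos p ≤ l) → at s (pos p) h₁ h₂ ≡ d

distinctCount : List ℕ → ℕ
distinctCount xs = length (deduplicate _≟_ xs)

{-# OPTIONS --safe #-}
-- Write a position of the expansion as x = 1 + 4q + t with t < 4, so that pos x = q + 1 and
-- s⁽¹⁾_x is s_{q+1} for t ∈ {0,1} and its complement for t ∈ {2,3}. The colour c together with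
-- s_{pos x} = d therefore confines all x_i to one window t = b + u with phase u ∈ {0,1}, where
-- b depends only on c and d. A jump of 2^e inside that window either keeps u and moves to a
-- later block (e ≥ 2, since 4 ∣ 2^e) or goes from u = 0 to u = 1 within one block (e = 0);
-- e = 1 always leaves the window. As u never decreases, the second kind of jump happens at
-- most once, so pos is strictly increasing along the sequence except for one repetition at most.
module Submission where

open import Defs
open import Data.Nat using (ℕ; zero; suc; _+_; _*_; _∸_; _^_; _≤_; _<_; z≤n; s≤s; s≤s⁻¹; _/_; NonZero)
open import Data.Nat.Properties
open import Data.Nat.DivMod using (m*n/n≡m; m<n⇒m/n≡0; +-distrib-/-∣ˡ)
open import Data.Nat.Divisibility using (n∣m*n)
open import Data.Nat.Tactic.RingSolver using (solve-∀)
open import Data.Bool using (Bool; true; false; not; _xor_; if_then_else_)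
open import Data.Bool.Properties using (xor-same; not-distribˡ-xor)
open import Data.Vec using (Vec)
open import Data.List using (List; []; _∷_; length; map; filter; deduplicate)
open import Data.List.Properties using (filter-all; filter-reject; filter-idem; length-map)
open import Data.List.Relation.Unary.All as All using (All; []; _∷_)
open import Data.List.Relation.Unary.All.Properties using (deduplicate⁺)
open import Data.List.Relation.Unary.AllPairs as AllPairs using ([]; _∷_)
open import Data.List.Relation.Unary.Linked using (Linked; []; [-]; _∷_)
open import Data.List.Relation.Unary.Linked.Properties using (Linked⇒All; Linked⇒AllPairs)
open import Data.List.Relation.Unary.Unique.Propositional using (Unique)
open import Data.Product using (∃; _×_; _,_)
import Data.Product as Product
open import Data.Sum using (_⊎_; inj₁; inj₂)
import Data.Sum as Sum
open import Function using (_∘_)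
open import Relation.Binary.Core using (Rel)
open import Relation.Binary.Definitions using (DecidableEquality; Transitive)
open import Relation.Nullary using (¬?; contradiction)
open import Relation.Binary.PropositionalEquality

module _ {a} {A : Set a} (_≟_ : DecidableEquality A) where

  deduplicate-Unique : ∀ {xs} → Unique xs → deduplicate _≟_ xs ≡ xs
  deduplicate-Unique {[]}     []            = refl
  deduplicate-Unique {x ∷ xs} (x∉xs ∷ !xs) = cong (x ∷_) (begin
    filter (¬? ∘ (x ≟_)) (deduplicate _≟_ xs) ≡⟨ cong (filter (¬? ∘ (x ≟_))) (deduplicate-Unique !xs) ⟩
    filter (¬? ∘ (x ≟_)) xs                   ≡⟨ filter-all (¬? ∘ (x ≟_)) x∉xs ⟩
    xs                                         ∎)
    where open ≡-Reasoning

  deduplicate-∷-fresh : ∀ {x xs} → All (x ≢_) xs → deduplicate _≟_ (x ∷ xs) ≡ x ∷ deduplicate _≟_ xs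
  deduplicate-∷-fresh {x} x∉xs = cong (x ∷_) (filter-all (¬? ∘ (x ≟_)) (deduplicate⁺ _≟_ x∉xs))

  deduplicate-∷-repeat : ∀ x xs → deduplicate _≟_ (x ∷ x ∷ xs) ≡ deduplicate _≟_ (x ∷ xs)
  deduplicate-∷-repeat x xs = cong (x ∷_) (begin
    filter x≢? (x ∷ filter x≢? (deduplicate _≟_ xs)) ≡⟨ filter-reject x≢? (λ x≢x → x≢x refl) ⟩
    filter x≢? (filter x≢? (deduplicate _≟_ xs))     ≡⟨ filter-idem x≢? (deduplicate _≟_ xs) ⟩
    filter x≢? (deduplicate _≟_ xs)                   ∎)
    where
    open ≡-Reasoning
    x≢? = ¬? ∘ (x ≟_)

Linked⇒All-head : ∀ {a ℓ} {A : Set a} {R : Rel A ℓ} → Transitive R →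
                  ∀ {x xs} → Linked R (x ∷ xs) → All (R x) xs
Linked⇒All-head R-trans [-]         = []
Linked⇒All-head R-trans (Rxy ∷ Rys) = Linked⇒All R-trans Rxy Rys

distinctCount-increasing : ∀ {ns} → Linked _<_ ns → distinctCount ns ≡ length ns
distinctCount-increasing ns↑ =
  cong length (deduplicate-Unique _≟_ (AllPairs.map <⇒≢ (Linked⇒AllPairs <-trans ns↑)))

data IncreasingUpToOneRepeat : List ℕ → Set where
  increasing : ∀ {ns} → Linked _<_ ns → IncreasingUpToOneRepeat ns
  _∷_        : ∀ {m n ns} → m < n → IncreasingUpToOneRepeat (n ∷ ns) →
               IncreasingUpToOneRepeat (m ∷ n ∷ ns)
  repeat     : ∀ {n ns} → Linked _<_ (n ∷ ns) → IncreasingUpToOneRepeat (n ∷ n ∷ ns)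

IncreasingUpToOneRepeat-head≤ : ∀ {n ns} → IncreasingUpToOneRepeat (n ∷ ns) → All (n ≤_) ns
IncreasingUpToOneRepeat-head≤ (increasing ns↑) = All.map <⇒≤ (Linked⇒All-head <-trans ns↑)
IncreasingUpToOneRepeat-head≤ (m<n ∷ ns↑)      =
  <⇒≤ m<n ∷ All.map (≤-trans (<⇒≤ m<n)) (IncreasingUpToOneRepeat-head≤ ns↑)
IncreasingUpToOneRepeat-head≤ (repeat ns↑)     = ≤-refl ∷ All.map <⇒≤ (Linked⇒All-head <-trans ns↑)

length∸1≤distinctCount : ∀ {ns} → IncreasingUpToOneRepeat ns → length ns ∸ 1 ≤ distinctCount ns
length∸1≤distinctCount {ns} (increasing ns↑) =
  ≤-trans (m∸n≤m (length ns) 1) (≤-reflexive (sym (distinctCount-increasing ns↑)))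
length∸1≤distinctCount (_∷_ {m} {n} {ns} m<n ns↑) = begin
  length (n ∷ ns)               ≤⟨ s≤s (length∸1≤distinctCount ns↑) ⟩
  suc (distinctCount (n ∷ ns))  ≡⟨ cong length (deduplicate-∷-fresh _≟_ m∉) ⟨
  distinctCount (m ∷ n ∷ ns)    ∎
  where
  open ≤-Reasoning
  m∉ : All (m ≢_) (n ∷ ns)
  m∉ = <⇒≢ m<n ∷ All.map (<⇒≢ ∘ <-≤-trans m<n) (IncreasingUpToOneRepeat-head≤ ns↑)
length∸1≤distinctCount (repeat {n} {ns} ns↑) = ≤-reflexive (sym (begin
  distinctCount (n ∷ n ∷ ns) ≡⟨ cong length (deduplicate-∷-repeat _≟_ n ns) ⟩
  distinctCount (n ∷ ns)     ≡⟨ distinctCount-increasing ns↑ ⟩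
  length (n ∷ ns)            ∎))
  where open ≡-Reasoning

[m*n+r]/n≡m : ∀ m {n r} .{{_ : NonZero n}} → r < n → (m * n + r) / n ≡ m
[m*n+r]/n≡m m {n} {r} r<n = begin
  (m * n + r) / n    ≡⟨ +-distrib-/-∣ˡ r (n∣m*n m) ⟩
  m * n / n + r / n  ≡⟨ cong₂ _+_ (m*n/n≡m m n) (m<n⇒m/n≡0 r<n) ⟩
  m + 0              ≡⟨ +-identityʳ m ⟩
  m                  ∎
  where open ≡-Reasoning

m*n+r-injective : ∀ {m m′ n r r′} .{{_ : NonZero n}} → r < n → r′ < n →
                  m * n + r ≡ m′ * n + r′ → m ≡ m′ × r ≡ r′
m*n+r-injective {m} {m′} {n} {r} {r′} r<n r′<n eq = m≡m′ , r≡r′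
  where
  m≡m′ : m ≡ m′
  m≡m′ = trans (sym ([m*n+r]/n≡m m r<n)) (trans (cong (_/ n) eq) ([m*n+r]/n≡m m′ r′<n))
  r≡r′ : r ≡ r′
  r≡r′ = +-cancelˡ-≡ (m * n) r r′ (trans eq (cong (λ k → k * n + r′) (sym m≡m′)))

pos-block : ∀ q {t} → t < 4 → pos (suc (q * 4 + t)) ≡ suc q
pos-block q t<4 = cong suc ([m*n+r]/n≡m q t<4)

phase<4 : ∀ {u k} → u ≤ 1 → k ≤ 2 → k + u < 4
phase<4 u≤1 k≤2 = s≤s (+-mono-≤ k≤2 u≤1)

short-jump : ∀ {q u q′ u′} k → u ≤ 1 → u′ ≤ 1 → k ≤ 2 →
             q * 4 + u + k ≡ q′ * 4 + u′ → q ≡ q′ × k + u ≡ u′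
short-jump {q} {u} k u≤1 u′≤1 k≤2 eq = m*n+r-injective (phase<4 u≤1 k≤2) (phase<4 u′≤1 z≤n) (begin
  q * 4 + (k + u)  ≡⟨ cong (q * 4 +_) (+-comm k u) ⟩
  q * 4 + (u + k)  ≡⟨ +-assoc (q * 4) u k ⟨
  q * 4 + u + k    ≡⟨ eq ⟩
  _                ∎)
  where open ≡-Reasoning

long-jump : ∀ q u m → (q + m) * 4 + u ≡ q * 4 + u + 2 * (2 * m)
long-jump = solve-∀

phase-step : ∀ {q u q′ u′} e → u ≤ 1 → u′ ≤ 1 → q * 4 + u + 2 ^ e ≡ q′ * 4 + u′ →
             (q < q′ × u ≡ u′) ⊎ (q ≡ q′ × u ≡ 0 × u′ ≡ 1)
phase-step {q} {u} {q′} {u′} zero u≤1 u′≤1 eq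
  with refl , refl ← short-jump {q} {u} {q′} {u′} 1 u≤1 u′≤1 (s≤s z≤n) eq
  = let u≡0 = n≤0⇒n≡0 (s≤s⁻¹ u′≤1) in inj₂ (refl , u≡0 , cong suc u≡0)
phase-step {q} {u} {q′} {u′} (suc zero) u≤1 u′≤1 eq
  with refl , refl ← short-jump {q} {u} {q′} {u′} 2 u≤1 u′≤1 ≤-refl eq
  = contradiction u′≤1 λ { (s≤s ()) }
phase-step {q} {u} (suc (suc e)) u≤1 u′≤1 eq
  with q+2^e≡q′ , u≡u′ ← m*n+r-injective (phase<4 u≤1 z≤n) (phase<4 u′≤1 z≤n)
                                          (trans (long-jump q u (2 ^ e)) eq)
  = inj₁ (subst (q <_) q+2^e≡q′ (m<m+n q (m^n>0 2 e)) , u≡u′)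

record InWindow (b x : ℕ) : Set where
  constructor window
  field
    block    : ℕ
    phase    : ℕ
    phase≤1  : phase ≤ 1
    position : x ≡ suc (block * 4 + (b + phase))

open InWindow using (block; phase)

block-shift : ∀ q b u → q * 4 + (b + u) ≡ b + (q * 4 + u)
block-shift = solve-∀

module _ {b : ℕ} (b≤2 : b ≤ 2) where

  pos-inWindow : ∀ {x} (w : InWindow b x) → pos x ≡ suc (block w)
  pos-inWindow (window q u u≤1 refl) = pos-block q (phase<4 u≤1 b≤2)

  inWindow-step : ∀ {x y} (wx : InWindow b x) (wy : InWindow b y) → x < y → InD (y ∸ x) →
                  (pos x < pos y × phase wx ≡ phase wy) ⊎ (pos x ≡ pos y × phase wx ≡ 0 × phase wy ≡ 1)
  inWindow-step wx@(window q u u≤1 refl) wy@(window q′ u′ u′≤1 refl) x<y (e , y∸x≡2^e) =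
    Sum.map (Product.map₁ λ q<q′ → subst₂ _<_ (sym px≡) (sym py≡) (s≤s q<q′))
            (Product.map₁ λ q≡q′ → trans px≡ (trans (cong suc q≡q′) (sym py≡)))
            (phase-step e u≤1 u′≤1 blocks)
    where
    open ≡-Reasoning
    px≡ = pos-inWindow wx
    py≡ = pos-inWindow wy
    x+2^e≡y : suc (q * 4 + (b + u)) + 2 ^ e ≡ suc (q′ * 4 + (b + u′))
    x+2^e≡y = trans (cong (suc (q * 4 + (b + u)) +_) (sym y∸x≡2^e)) (m+[n∸m]≡n (<⇒≤ x<y))
    blocks : q * 4 + u + 2 ^ e ≡ q′ * 4 + u′
    blocks = +-cancelˡ-≡ b _ _ (begin
      b + (q * 4 + u + 2 ^ e)   ≡⟨ +-assoc b (q * 4 + u) (2 ^ e) ⟨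
      b + (q * 4 + u) + 2 ^ e   ≡⟨ cong (_+ 2 ^ e) (block-shift q b u) ⟨
      q * 4 + (b + u) + 2 ^ e   ≡⟨ suc-injective x+2^e≡y ⟩
      q′ * 4 + (b + u′)         ≡⟨ block-shift q′ b u′ ⟩
      b + (q′ * 4 + u′)         ∎)

  increasing-from-upper-phase : ∀ {x xs} → DiffSeq (x ∷ xs) → (w : InWindow b x) → phase w ≡ 1 →
                                All (InWindow b) xs → Linked _<_ (map pos (x ∷ xs))
  increasing-from-upper-phase _ _ _ [] = [-]
  increasing-from-upper-phase (cons _ x<y y∸x∈D ds) w upper (w′ ∷ ws)
    with inWindow-step w w′ x<y y∸x∈D
  ... | inj₁ (px<py , same-phase) =
    px<py ∷ increasing-from-upper-phase ds w′ (trans (sym same-phase) upper) ws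
  ... | inj₂ (_ , lower , _) = contradiction (trans (sym upper) lower) 1+n≢0

  pos-increasingUpToOneRepeat : ∀ {xs} → DiffSeq xs → All (InWindow b) xs →
                                IncreasingUpToOneRepeat (map pos xs)
  pos-increasingUpToOneRepeat nil     []       = increasing []
  pos-increasingUpToOneRepeat (one _) (_ ∷ []) = increasing [-]
  pos-increasingUpToOneRepeat (cons _ x<y y∸x∈D ds) (w ∷ w′ ∷ ws)
    with inWindow-step w w′ x<y y∸x∈D
  ... | inj₁ (px<py , _) = px<py ∷ pos-increasingUpToOneRepeat ds (w′ ∷ ws)
  ... | inj₂ (px≡py , _ , upper) rewrite px≡py = repeat (increasing-from-upper-phase ds w′ upper ws)

-- The expansion of a bit d is the block d d ¬d ¬d, so positions of colour c in it occupy
-- the offsets colourOffset c d and colourOffset c d + 1.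
colourOffset : Bool → Bool → ℕ
colourOffset c d = if c xor d then 2 else 0

colourOffset≤2 : ∀ c d → colourOffset c d ≤ 2
colourOffset≤2 c d with c xor d
... | true  = ≤-refl
... | false = z≤n

at-cong : ∀ {l} (s : Vec Bool l) {i i′} {1≤i i≤l 1≤i′ i′≤l} → i ≡ i′ →
          at s i 1≤i i≤l ≡ at s i′ 1≤i′ i′≤l
at-cong s {i} refl = cong₂ (at s i) (≤-irrelevant _ _) (≤-irrelevant _ _)

block-offset : ∀ {x j q} → j < 4 → x + j ≡ 4 * suc q → x ≡ suc (q * 4 + (3 ∸ j))
block-offset {x} {j} {q} j<4 x+j≡4i = +-cancelʳ-≡ j x _ (begin
  x + j                       ≡⟨ x+j≡4i ⟩
  4 * suc q                   ≡⟨ 4[1+q]≡ q ⟩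
  suc (q * 4 + 3)             ≡⟨ cong (λ t → suc (q * 4 + t)) (m∸n+n≡m (s≤s⁻¹ j<4)) ⟨
  suc (q * 4 + (3 ∸ j + j))   ≡⟨ cong suc (+-assoc (q * 4) (3 ∸ j) j) ⟨
  suc (q * 4 + (3 ∸ j)) + j   ∎)
  where
  open ≡-Reasoning
  4[1+q]≡ : ∀ q → 4 * suc q ≡ suc (q * 4 + 3)
  4[1+q]≡ = solve-∀

offset-inWindow : ∀ {c a j} → ((j ≡ 2 ⊎ j ≡ 3) × c ≡ a) ⊎ ((j ≡ 0 ⊎ j ≡ 1) × c ≡ not a) →
                  ∃ λ u → u ≤ 1 × 3 ∸ j ≡ colourOffset c a + u
offset-inWindow {a = a} (inj₁ (inj₁ refl , refl)) rewrite xor-same a = 1 , ≤-refl , refl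
offset-inWindow {a = a} (inj₁ (inj₂ refl , refl)) rewrite xor-same a = 0 , z≤n , refl
offset-inWindow {a = a} (inj₂ (inj₁ refl , refl))
  rewrite sym (not-distribˡ-xor a a) | xor-same a = 1 , ≤-refl , refl
offset-inWindow {a = a} (inj₂ (inj₂ refl , refl))
  rewrite sym (not-distribˡ-xor a a) | xor-same a = 0 , z≤n , refl

expansion-inWindow : ∀ {l} (s : Vec Bool l) {x c d} → Exp s x c → AtPos s x d →
                     InWindow (colourOffset c d) x
expansion-inWindow s {x} {c} {d} (suc q , j , 1≤i , i≤l , j<4 , x+j≡4i , colour) (1≤p , p≤l , sₚ≡d)
  with u , u≤1 , offset≡ ← offset-inWindow colour
  = subst (λ a → InWindow (colourOffset c a) x) sᵢ≡d
      (window q u u≤1 (trans x≡ (cong (λ t → suc (q * 4 + t)) offset≡)))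
  where
  x≡ : x ≡ suc (q * 4 + (3 ∸ j))
  x≡ = block-offset j<4 x+j≡4i
  pos≡i : pos x ≡ suc q
  pos≡i = trans (cong pos x≡) (pos-block q (s≤s (m∸n≤m 3 j)))
  sᵢ≡d : at s (suc q) 1≤i i≤l ≡ d
  sᵢ≡d = trans (at-cong s {1≤i = 1≤i} {i≤l} {1≤p} {p≤l} (sym pos≡i)) sₚ≡d

corollary2 : ∀ {l : ℕ} (s : Vec Bool l) (xs : List ℕ) (c : Bool) →
    DiffSeq xs →
    All (ValidPos l) xs →
    All (λ x → Exp s x c) xs →
    (∃ λ (d : Bool) → All (λ x → AtPos s x d) xs) →
    length xs ∸ 1 ≤ distinctCount (map pos xs)
corollary2 s xs c diffSeq _ colours (d , bits) =
  subst (λ n → n ∸ 1 ≤ distinctCount (map pos xs)) (length-map pos xs)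
    (length∸1≤distinctCount
      (pos-increasingUpToOneRepeat (colourOffset≤2 c d) diffSeq
        (All.zipWith (λ (e , a) → expansion-inWindow s e a) (colours , bits))))
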